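{- If $R$ is a discrete valuation ring, then $\Gamma_0(R)$ has no edges.
   Context: All rings are commutative with identity. $\Gamma_0(R)$ is the simple graph whose vertices are the non-trivial ideals of $R$ (ideals other than $0$ and $R$), two distinct ideals $I,J$ being adjacent iff $IJ=I\cap J$. A discrete valuation ring is a principal ideal domain with exactly one nonzero maximal ideal. -}

module Defs where

open import Level using (Level; _⊔_; suc; Lift; lift)
open import Algebra.Bundles using (CommutativeRing)
open import Data.Product using (Σ; ∃; _×_; _,_; proj₁; proj₂)
open import Data.Sum using (_⊎_)
open import Data.Unit.Polymorphic using (⊤)
open import Data.List using (List; map; foldr)
open import Data.List.Relation.Unary.All using (All)
open import Relation.Nullary using (¬_)

module RingTheory {c ℓ : Level} (R : CommutativeRing c ℓ) where
  open CommutativeRing R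

  Subset : Set (suc (c ⊔ ℓ))
  Subset = Carrier → Set (c ⊔ ℓ)

  record Ideal : Set (suc (c ⊔ ℓ)) where
    field
      mem    : Subset
      resp   : ∀ {x y} → x ≈ y → mem x → mem y
      has0   : mem 0#
      +-clos : ∀ {x y} → mem x → mem y → mem (x + y)
      *-clos : ∀ r {x} → mem x → mem (r * x)
  open Ideal public

  _⊆_ : Subset → Subset → Set (c ⊔ ℓ)
  A ⊆ B = ∀ x → A x → B x

  _≐_ : Subset → Subset → Set (c ⊔ ℓ)
  A ≐ B = (A ⊆ B) × (B ⊆ A)

  zeroSet : Subset
  zeroSet x = Lift c (x ≈ 0#)

  wholeSet : Subset
  wholeSet x = ⊤

  principal : Carrier → Subset
  principal a x = ∃ λ r → x ≈ r * a

  _∩_ : Subset → Subset → Subset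
  (A ∩ B) x = A x × B x

  sumList : List Carrier → Carrier
  sumList = foldr _+_ 0#

  _·_ : Subset → Subset → Subset
  (A · B) x = ∃ λ (ps : List (Carrier × Carrier)) →
      All (λ p → A (proj₁ p) × B (proj₂ p)) ps
    × x ≈ sumList (map (λ p → proj₁ p * proj₂ p) ps)

  NonTrivial : Ideal → Set (c ⊔ ℓ)
  NonTrivial I = ¬ (mem I ≐ zeroSet) × ¬ (mem I ≐ wholeSet)

  IsDomain : Set (c ⊔ ℓ)
  IsDomain = ¬ (1# ≈ 0#) × (∀ a b → a * b ≈ 0# → (a ≈ 0#) ⊎ (b ≈ 0#))

  AllPrincipal : Set (suc (c ⊔ ℓ))
  AllPrincipal = ∀ (I : Ideal) → ∃ λ a → mem I ≐ principal a

  IsPID : Set (suc (c ⊔ ℓ))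
  IsPID = IsDomain × AllPrincipal

  IsMaximal : Ideal → Set (suc (c ⊔ ℓ))
  IsMaximal M = ¬ (mem M ≐ wholeSet)
    × (∀ (J : Ideal) → mem M ⊆ mem J → (mem J ≐ mem M) ⊎ (mem J ≐ wholeSet))

  IsDVR : Set (suc (c ⊔ ℓ))
  IsDVR = IsPID × (Σ Ideal λ M → IsMaximal M × ¬ (mem M ≐ zeroSet)
    × (∀ (N : Ideal) → IsMaximal N → ¬ (mem N ≐ zeroSet) → mem N ≐ mem M))

  Adjacent : Ideal → Ideal → Set (c ⊔ ℓ)
  Adjacent I J = NonTrivial I × NonTrivial J × ¬ (mem I ≐ mem J)
    × ((mem I · mem J) ≐ (mem I ∩ mem J))

  Γ₀HasNoEdges : Set (suc (c ⊔ ℓ))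
  Γ₀HasNoEdges = ∀ (I J : Ideal) → ¬ Adjacent I J

module Submission where

-- Γ₀ of a discrete valuation ring R has no edges; in fact no two non-trivial
-- ideals I, J of R satisfy I J = I ∩ J.
--
-- Write I = (a), J = (b) with a, b nonzero nonunits.  Every common multiple of
-- a and b lies in I ∩ J ⊆ I J ⊆ (a b).  In a principal ideal domain this forces
-- (a, b) = R: if (a, b) = (d) with a = a'd, b = b'd, then a'b is a common
-- multiple, so a'b'd = t·a'd·b'd and cancelling gives t d = 1.  But a and b lie
-- in the maximal ideal M, hence so does 1 ∈ (a, b), which is absurd.
--
-- That every nonzero nonunit lies in M is the only non-algebraic step, proved
-- constructively as follows.  A maximal ideal M decides every proposition P
-- (look at the ideal M ∪ {x | P}), so classical reasoning is available.  In a
-- PID, ascending chains of principal ideals stabilise, which yields a maximal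
-- ideal (y) above any nonunit x; if x ≠ 0 then y ≠ 0 and uniqueness of the
-- nonzero maximal ideal gives (y) = M.

open import Defs
open import Level using (Level; _⊔_; lift; lower)
open import Algebra.Bundles using (CommutativeRing)
open import Data.Product using (∃; ∃₂; _×_; _,_; proj₁; proj₂)
open import Data.Sum using (_⊎_; inj₁; inj₂)
open import Data.Empty using (⊥-elim)
open import Data.Nat using (ℕ; zero; suc) renaming (_+_ to _+ℕ_)
open import Data.Nat.Properties using () renaming (+-comm to +ℕ-comm)
open import Data.List using ([]; _∷_; map)
open import Data.List.Relation.Unary.All using (All; []; _∷_)
open import Relation.Nullary using (¬_)
open import Relation.Binary.PropositionalEquality using (subst)
open import Data.Unit.Polymorphic using (tt)
import Algebra.Properties.CommutativeSemigroup as CommSemigroupProperties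

module Theory {c ℓ : Level} (R : CommutativeRing c ℓ) where
  open CommutativeRing R hiding (zero)
  open RingTheory R
  open CommSemigroupProperties +-commutativeSemigroup using ()
    renaming (interchange to +-interchange)
  open CommSemigroupProperties *-commutativeSemigroup using ()
    renaming (interchange to *-interchange; x∙yz≈y∙xz to *-leftSwap)
  open import Relation.Binary.Reasoning.Setoid setoid

  L : Level
  L = c ⊔ ℓ

  _∣_ : Carrier → Carrier → Set L
  a ∣ x = principal a x

  Unit : Carrier → Set L
  Unit a = a ∣ 1#

  ∣-refl : ∀ {a} → a ∣ a
  ∣-refl {a} = 1# , sym (*-identityˡ a)

  ∣-trans : ∀ {a b x} → a ∣ b → b ∣ x → a ∣ x
  ∣-trans {a} (s , b≈sa) (r , x≈rb) =
    r * s , trans x≈rb (trans (*-congˡ b≈sa) (sym (*-assoc r s a)))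

  ∣-zero : ∀ {a x} → a ∣ x → a ≈ 0# → x ≈ 0#
  ∣-zero {a} (r , x≈ra) a≈0 = trans x≈ra (trans (*-congˡ a≈0) (zeroʳ r))

  principalIdeal : Carrier → Ideal
  principalIdeal a = record
    { mem    = principal a
    ; resp   = λ { x≈y (r , x≈ra) → r , trans (sym x≈y) x≈ra }
    ; has0   = 0# , sym (zeroˡ a)
    ; +-clos = λ { (r , x≈ra) (s , y≈sa) →
                   r + s , trans (+-cong x≈ra y≈sa) (sym (distribʳ a r s)) }
    ; *-clos = λ t → λ { (r , x≈ra) →
                   t * r , trans (*-congˡ x≈ra) (sym (*-assoc t r a)) }
    }

  whole-if-1 : (K : Ideal) → mem K 1# → mem K ≐ wholeSet
  whole-if-1 K 1∈K = (λ _ _ → tt) , λ x _ → resp K (*-identityʳ x) (*-clos K x 1∈K)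

  Decided : Set L → Set L
  Decided P = P ⊎ ¬ P

  -- A maximal ideal M decides every proposition P: the ideal M ∪ {x | P} is
  -- either M (so ¬ P) or the whole ring (so P, since 1 ∉ M).
  maximal⇒excludedMiddle : (M : Ideal) → IsMaximal M → (P : Set L) → Decided P
  maximal⇒excludedMiddle M (M-proper , M-maximal) P
    with M-maximal M∪P (λ _ → inj₁)
    where
    M∪P : Ideal
    M∪P = record
      { mem    = λ x → mem M x ⊎ P
      ; resp   = λ { x≈y (inj₁ x∈M) → inj₁ (resp M x≈y x∈M) ; _ (inj₂ p) → inj₂ p }
      ; has0   = inj₁ (has0 M)
      ; +-clos = λ { (inj₁ x∈M) (inj₁ y∈M) → inj₁ (+-clos M x∈M y∈M)
                   ; (inj₁ _) (inj₂ p) → inj₂ p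
                   ; (inj₂ p) _ → inj₂ p }
      ; *-clos = λ r → λ { (inj₁ x∈M) → inj₁ (*-clos M r x∈M) ; (inj₂ p) → inj₂ p }
      }
  ... | inj₁ (M∪P⊆M , _) = inj₂ λ p → M-proper (whole-if-1 M (M∪P⊆M 1# (inj₂ p)))
  ... | inj₂ (_ , R⊆M∪P) with R⊆M∪P 1# tt
  ...   | inj₁ 1∈M = ⊥-elim (M-proper (whole-if-1 M 1∈M))
  ...   | inj₂ p   = inj₁ p

  module MaximalAbove (pid : AllPrincipal) (lem : (P : Set L) → Decided P) where

    Enlargeable : Carrier → Set L
    Enlargeable y = ∃ λ z → z ∣ y × ¬ (y ∣ z) × ¬ Unit z

    enlarge : ∀ y → Decided (Enlargeable y) → Carrier
    enlarge y (inj₁ (z , _)) = z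
    enlarge y (inj₂ _)       = y

    next : Carrier → Carrier
    next y = enlarge y (lem (Enlargeable y))

    next-divides : ∀ y → next y ∣ y
    next-divides y with lem (Enlargeable y)
    ... | inj₁ (_ , z∣y , _) = z∣y
    ... | inj₂ _             = ∣-refl

    next-nonunit : ∀ y → ¬ Unit y → ¬ Unit (next y)
    next-nonunit y y-nonunit with lem (Enlargeable y)
    ... | inj₁ (_ , _ , _ , z-nonunit) = z-nonunit
    ... | inj₂ _                       = y-nonunit

    stable⇒not-enlargeable : ∀ y → y ∣ next y → ¬ Enlargeable y
    stable⇒not-enlargeable y y∣next with lem (Enlargeable y)
    ... | inj₁ (_ , _ , y∤z , _) = ⊥-elim (y∤z y∣next)
    ... | inj₂ not-enlargeable   = not-enlargeable

    -- A proper principal ideal that cannot be enlarged is maximal, since every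
    -- ideal is principal.
    not-enlargeable⇒maximal : ∀ y → ¬ Enlargeable y → ¬ Unit y →
                              IsMaximal (principalIdeal y)
    not-enlargeable⇒maximal y not-enlargeable y-nonunit =
      (λ y≐R → y-nonunit (proj₂ y≐R 1# tt)) , extend
      where
      extend : (J : Ideal) → principal y ⊆ mem J →
               (mem J ≐ principal y) ⊎ (mem J ≐ wholeSet)
      extend J y⊆J with pid J
      ... | g , J⊆g , g⊆J with lem (mem J 1#)
      ...   | inj₁ 1∈J = inj₂ (whole-if-1 J 1∈J)
      ...   | inj₂ 1∉J with lem (y ∣ g)
      ...     | inj₁ y∣g = inj₁ ((λ z z∈J → ∣-trans y∣g (J⊆g z z∈J)) , y⊆J)
      ...     | inj₂ y∤g = ⊥-elim (not-enlargeable
                  (g , J⊆g y (y⊆J y ∣-refl) , y∤g , λ g-unit → 1∉J (g⊆J 1# g-unit)))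

    module Chain (x : Carrier) (x-nonunit : ¬ Unit x) where
      chain : ℕ → Carrier
      chain zero    = x
      chain (suc n) = next (chain n)

      chain-nonunit : ∀ n → ¬ Unit (chain n)
      chain-nonunit zero    = x-nonunit
      chain-nonunit (suc n) = next-nonunit (chain n) (chain-nonunit n)

      chain-grows : ∀ k n → chain (k +ℕ n) ∣ chain n
      chain-grows zero    n = ∣-refl
      chain-grows (suc k) n = ∣-trans (next-divides (chain (k +ℕ n))) (chain-grows k n)

      chain-divides-start : ∀ n → chain n ∣ x
      chain-divides-start zero    = ∣-refl
      chain-divides-start (suc n) = ∣-trans (next-divides (chain n)) (chain-divides-start n)

      union : Ideal
      union = record
        { mem    = λ z → ∃ λ n → chain n ∣ z
        ; resp   = λ { z≈w (n , n∣z) → n , resp (principalIdeal (chain n)) z≈w n∣z }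
        ; has0   = zero , has0 (principalIdeal x)
        ; +-clos = λ { (n , n∣z) (m , m∣w) → n +ℕ m ,
                       +-clos (principalIdeal (chain (n +ℕ m)))
                         (∣-trans (subst (λ i → chain i ∣ chain n) (+ℕ-comm m n)
                                         (chain-grows m n)) n∣z)
                         (∣-trans (chain-grows n m) m∣w) }
        ; *-clos = λ r → λ { (n , n∣z) → n , *-clos (principalIdeal (chain n)) r n∣z }
        }

      -- The union is principal, and its generator already lies in some (chain n);
      -- so the chain stabilises there and (chain n) is maximal.
      maximal-above : ∃ λ y → y ∣ x × IsMaximal (principalIdeal y)
      maximal-above with pid union
      ... | g , union⊆g , g⊆union with g⊆union g ∣-refl
      ...   | n , n∣g = chain n , chain-divides-start n ,
                not-enlargeable⇒maximal (chain n)
                  (stable⇒not-enlargeable (chain n)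
                    (∣-trans n∣g (union⊆g (chain (suc n)) (suc n , ∣-refl))))
                  (chain-nonunit n)

  product⊆principal : ∀ {A B : Subset} {x y} → A ⊆ principal x → B ⊆ principal y →
                      (A · B) ⊆ principal (x * y)
  product⊆principal {A} {B} {x} {y} A⊆x B⊆y z (ps , ps∈A×B , z≈sum) =
    divides-z (sum-divisible ps ps∈A×B)
    where
    divides-z : (x * y) ∣ sumList (map (λ p → proj₁ p * proj₂ p) ps) → (x * y) ∣ z
    divides-z (t , sum≈t·xy) = t , trans z≈sum sum≈t·xy

    sum-divisible : ∀ qs → All (λ p → A (proj₁ p) × B (proj₂ p)) qs →
                    (x * y) ∣ sumList (map (λ p → proj₁ p * proj₂ p) qs)
    sum-divisible []             []                  = 0# , sym (zeroˡ (x * y))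
    sum-divisible ((a , b) ∷ qs) ((a∈A , b∈B) ∷ all) with A⊆x a a∈A | B⊆y b b∈B
                                                        | sum-divisible qs all
    ... | u , a≈ux | v , b≈vy | t , rest≈t·xy =
      u * v + t ,
      (begin
        a * b + rest                    ≈⟨ +-cong (*-cong a≈ux b≈vy) rest≈t·xy ⟩
        (u * x) * (v * y) + t * (x * y) ≈⟨ +-congʳ (*-interchange u x v y) ⟩
        (u * v) * (x * y) + t * (x * y) ≈⟨ sym (distribʳ (x * y) (u * v) t) ⟩
        (u * v + t) * (x * y)           ∎)
      where
      rest : Carrier
      rest = sumList (map (λ p → proj₁ p * proj₂ p) qs)

  linear-combination-scale : ∀ t r s a b → t * (r * a + s * b) ≈ (t * r) * a + (t * s) * b
  linear-combination-scale t r s a b =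
    trans (distribˡ t (r * a) (s * b)) (+-cong (sym (*-assoc t r a)) (sym (*-assoc t s b)))

  pairIdeal : Carrier → Carrier → Ideal
  pairIdeal a b = record
    { mem    = λ z → ∃₂ λ r s → z ≈ r * a + s * b
    ; resp   = λ { z≈w (r , s , z≈) → r , s , trans (sym z≈w) z≈ }
    ; has0   = 0# , 0# , sym (trans (+-cong (zeroˡ a) (zeroˡ b)) (+-identityˡ 0#))
    ; +-clos = λ { (r , s , z≈) (r' , s' , w≈) → r + r' , s + s' ,
                   trans (+-cong z≈ w≈) (linear-combination-add r s r' s') }
    ; *-clos = λ t → λ { (r , s , z≈) → t * r , t * s ,
                   trans (*-congˡ z≈) (linear-combination-scale t r s a b) }
    }
    where
    linear-combination-add : ∀ r s r' s' →
      (r * a + s * b) + (r' * a + s' * b) ≈ (r + r') * a + (s + s') * b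
    linear-combination-add r s r' s' =
      trans (+-interchange (r * a) (s * b) (r' * a) (s' * b))
            (+-cong (sym (distribʳ a r r')) (sym (distribʳ b s s')))

  bezout : AllPrincipal → ∀ a b →
           ∃ λ d → d ∣ a × d ∣ b × ∃₂ λ r s → d ≈ r * a + s * b
  bezout pid a b with pid (pairIdeal a b)
  ... | d , ab⊆d , d⊆ab =
    d , ab⊆d a (1# , 0# , a≈1a+0b) , ab⊆d b (0# , 1# , b≈0a+1b) , d⊆ab d ∣-refl
    where
    a≈1a+0b : a ≈ 1# * a + 0# * b
    a≈1a+0b = sym (trans (+-cong (*-identityˡ a) (zeroˡ b)) (+-identityʳ a))
    b≈0a+1b : b ≈ 0# * a + 1# * b
    b≈0a+1b = sym (trans (+-cong (zeroˡ a) (*-identityˡ b)) (+-identityˡ b))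

  module Domain (domain : IsDomain) where

    *-nonzero : ∀ {x y} → ¬ x ≈ 0# → ¬ y ≈ 0# → ¬ (x * y) ≈ 0#
    *-nonzero x≉0 y≉0 xy≈0 with proj₂ domain _ _ xy≈0
    ... | inj₁ x≈0 = x≉0 x≈0
    ... | inj₂ y≈0 = y≉0 y≈0

    *-cancelˡ : ∀ w u v → ¬ w ≈ 0# → w * u ≈ w * v → u ≈ v
    *-cancelˡ w u v w≉0 wu≈wv with proj₂ domain w (u - v) w[u-v]≈0
      where
      w[u-v]≈0 : w * (u - v) ≈ 0#
      w[u-v]≈0 = begin
        w * (u - v)     ≈⟨ distribˡ w u (- v) ⟩
        w * u + w * - v ≈⟨ +-congʳ wu≈wv ⟩
        w * v + w * - v ≈⟨ sym (distribˡ w v (- v)) ⟩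
        w * (v - v)     ≈⟨ *-congˡ (-‿inverseʳ v) ⟩
        w * 0#          ≈⟨ zeroʳ w ⟩
        0#              ∎
    ... | inj₁ w≈0   = ⊥-elim (w≉0 w≈0)
    ... | inj₂ u-v≈0 = begin
      u             ≈⟨ sym (+-identityʳ u) ⟩
      u + 0#        ≈⟨ +-congˡ (sym (-‿inverseˡ v)) ⟩
      u + (- v + v) ≈⟨ sym (+-assoc u (- v) v) ⟩
      (u - v) + v   ≈⟨ +-congʳ u-v≈0 ⟩
      0# + v        ≈⟨ +-identityˡ v ⟩
      v             ∎

    -- With (a, b) = (d), a = a'd, b = b'd, the common
    -- multiple a'b = a'b'd equals t·a'd·b'd; cancelling a'b'd gives 1 = t d.
    coprime-if-lcm-is-product :
      AllPrincipal → ∀ a b → ¬ a ≈ 0# → ¬ b ≈ 0# →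
      (∀ z → a ∣ z → b ∣ z → (a * b) ∣ z) → ∃₂ λ u v → 1# ≈ u * a + v * b
    coprime-if-lcm-is-product pid a b a≉0 b≉0 lcm=ab
      with bezout pid a b
    ... | d , (a' , a≈a'd) , (b' , b≈b'd) , r , s , d≈ra+sb
      with lcm=ab (a' * b) a∣a'b (a' , refl)
      where
      a∣a'b : a ∣ (a' * b)
      a∣a'b = b' , (begin
        a' * b        ≈⟨ *-congˡ b≈b'd ⟩
        a' * (b' * d) ≈⟨ *-leftSwap a' b' d ⟩
        b' * (a' * d) ≈⟨ *-congˡ (sym a≈a'd) ⟩
        b' * a        ∎)
    ... | t , a'b≈t·ab = t * r , t * s , (begin
      1#                      ≈⟨ 1≈td ⟩
      t * d                   ≈⟨ *-congˡ d≈ra+sb ⟩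
      t * (r * a + s * b)     ≈⟨ linear-combination-scale t r s a b ⟩
      (t * r) * a + (t * s) * b ∎)
      where
      w : Carrier
      w = a' * b' * d
      nonzero-cofactor : ∀ {x x'} → x ≈ x' * d → ¬ x ≈ 0# → ¬ x' ≈ 0#
      nonzero-cofactor x≈x'd x≉0 x'≈0 = x≉0 (trans x≈x'd (trans (*-congʳ x'≈0) (zeroˡ d)))
      d≉0 : ¬ d ≈ 0#
      d≉0 d≈0 = a≉0 (trans a≈a'd (trans (*-congˡ d≈0) (zeroʳ a')))
      w≉0 : ¬ w ≈ 0#
      w≉0 = *-nonzero (*-nonzero (nonzero-cofactor a≈a'd a≉0) (nonzero-cofactor b≈b'd b≉0)) d≉0
      w·1≈w·td : w * 1# ≈ w * (t * d)
      w·1≈w·td = begin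
        w * 1#                      ≈⟨ *-identityʳ w ⟩
        a' * b' * d                 ≈⟨ *-assoc a' b' d ⟩
        a' * (b' * d)               ≈⟨ *-congˡ (sym b≈b'd) ⟩
        a' * b                      ≈⟨ a'b≈t·ab ⟩
        t * (a * b)                 ≈⟨ *-congˡ (*-cong a≈a'd b≈b'd) ⟩
        t * ((a' * d) * (b' * d))   ≈⟨ *-congˡ (*-interchange a' d b' d) ⟩
        t * ((a' * b') * (d * d))   ≈⟨ *-congˡ (sym (*-assoc (a' * b') d d)) ⟩
        t * (w * d)                 ≈⟨ *-leftSwap t w d ⟩
        w * (t * d)                 ∎
      1≈td : 1# ≈ t * d
      1≈td = *-cancelˡ w 1# (t * d) w≉0 w·1≈w·td

  module DiscreteValuationRing (dvr : IsDVR) where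
    domain : IsDomain
    domain = proj₁ (proj₁ dvr)

    pid : AllPrincipal
    pid = proj₂ (proj₁ dvr)

    M : Ideal
    M = proj₁ (proj₂ dvr)
    open Domain domain

    M-maximal : IsMaximal M
    M-maximal = proj₁ (proj₂ (proj₂ dvr))

    M-unique : ∀ (N : Ideal) → IsMaximal N → ¬ (mem N ≐ zeroSet) → mem N ≐ mem M
    M-unique = proj₂ (proj₂ (proj₂ (proj₂ dvr)))

    1∉M : ¬ mem M 1#
    1∉M 1∈M = proj₁ M-maximal (whole-if-1 M 1∈M)

    open MaximalAbove pid (maximal⇒excludedMiddle M M-maximal)

    -- Every nonzero nonunit x lies in M: the maximal ideal (y) above x is
    -- nonzero since it contains x, hence equals M.
    nonunit∈M : ∀ x → ¬ x ≈ 0# → ¬ Unit x → mem M x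
    nonunit∈M x x≉0 x-nonunit with Chain.maximal-above x x-nonunit
    ... | y , y∣x , y-maximal = proj₁ (M-unique (principalIdeal y) y-maximal y≠0) x y∣x
      where
      y≠0 : ¬ (principal y ≐ zeroSet)
      y≠0 (y⊆0 , _) = x≉0 (lower (y⊆0 x y∣x))

    nonTrivial-generator : (I : Ideal) → NonTrivial I →
                           ∃ λ a → (mem I ≐ principal a) × ¬ a ≈ 0# × ¬ Unit a
    nonTrivial-generator I (I≠0 , I≠R) with pid I
    ... | a , I⊆a , a⊆I = a , (I⊆a , a⊆I) , a≉0 , a-nonunit
      where
      a≉0 : ¬ a ≈ 0#
      a≉0 a≈0 = I≠0 ( (λ z z∈I → lift (∣-zero (I⊆a z z∈I) a≈0))
                    , λ z z≈0 → resp I (sym (lower z≈0)) (has0 I))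
      a-nonunit : ¬ Unit a
      a-nonunit a-unit = I≠R (whole-if-1 I (a⊆I 1# a-unit))

    -- Two nonzero nonunits lie in M, so they cannot generate the unit ideal.
    nonunits-not-comaximal : ∀ {a b} → ¬ a ≈ 0# → ¬ Unit a → ¬ b ≈ 0# → ¬ Unit b →
                             ¬ (∃₂ λ u v → 1# ≈ u * a + v * b)
    nonunits-not-comaximal {a} {b} a≉0 a-nonunit b≉0 b-nonunit (u , v , 1≈ua+vb) =
      1∉M (resp M (sym 1≈ua+vb)
             (+-clos M (*-clos M u (nonunit∈M a a≉0 a-nonunit))
                       (*-clos M v (nonunit∈M b b≉0 b-nonunit))))

    no-edges : Γ₀HasNoEdges
    no-edges I J (I-nonTrivial , J-nonTrivial , _ , _ , I∩J⊆IJ)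
      with nonTrivial-generator I I-nonTrivial | nonTrivial-generator J J-nonTrivial
    ... | a , (I⊆a , a⊆I) , a≉0 , a-nonunit | b , (J⊆b , b⊆J) , b≉0 , b-nonunit =
      nonunits-not-comaximal a≉0 a-nonunit b≉0 b-nonunit
        (coprime-if-lcm-is-product pid a b a≉0 b≉0 common-multiple-divisible)
      where
      common-multiple-divisible : ∀ z → a ∣ z → b ∣ z → (a * b) ∣ z
      common-multiple-divisible z a∣z b∣z =
        product⊆principal I⊆a J⊆b z (I∩J⊆IJ z (a⊆I z a∣z , b⊆J z b∣z))

mainTheorem7 : ∀ {c ℓ : Level} (R : CommutativeRing c ℓ) →
    RingTheory.IsDVR R → RingTheory.Γ₀HasNoEdges R
mainTheorem7 R dvr = Theory.DiscreteValuationRing.no-edges R dvr
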